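{- Let $(\alpha_1,\dots,\alpha_k)$ be an admissible $k$-tuple of elements of $\mathcal{NCP}(n)$. Then $$\alpha_1\circ\cdots\circ\alpha_k=\Big((\alpha_1\ast_n\cdots\ast_n\alpha_k)\vee\{\{1,\dots,k\},\{k+1,\dots,2k\},\dots,\{kn-k+1,\dots,kn\}\}\Big)^{1/k}.$$
   Context: A partition of $[m]=\{1,\dots,m\}$ is noncrossing if there are no two distinct blocks $B,C$ and $a<b<c<d$ with $a,c\in B$, $b,d\in C$. $\mathcal{NCP}(m)$ is the lattice of noncrossing partitions of $[m]$ under refinement, with join $\vee$ (the join on the right-hand side is taken in $\mathcal{NCP}(kn)$). For $\alpha_1,\dots,\alpha_k\in\mathcal{NCP}(n)$, $\alpha_1\ast_n\cdots\ast_n\alpha_k$ is the partition of $[kn]$ with blocks $\{k(x-1)+i:x\in B\}$ for $1\le i\le k$ and $B$ a block of $\alpha_i$; the $k$-tuple is admissible if this partition is noncrossing. For $\gamma\in\mathcal{NCP}(kn)$ in which each set $\{(i-1)k+1,\dots,ik\}$ ($1\le i\le n$) lies in a single block, $\gamma^{1/k}\in\mathcal{NCP}(n)$ is the partition with blocks $\{i:ik\in D\}$, $D$ a block of $\gamma$. For an admissible pair $(\alpha,\beta)$ in $\mathcal{NCP}(n)$, $\alpha\circ\beta:=\big((\alpha\ast_n\beta)\vee\{\{1,2\},\dots,\{2n-1,2n\}\}\big)^{1/2}$; $\circ$ is undefined on non-admissible pairs and is an associative partial operation, so $\alpha_1\circ\cdots\circ\alpha_k$ denotes the iterated product. -}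

module Defs where

open import Data.Nat using (ℕ; zero; suc; _*_)
open import Data.Fin using (Fin; _<_; combine; quotient; remainder; fromℕ)
open import Data.Product using (Σ; _×_; _,_)
open import Data.Vec using (Vec; []; _∷_; lookup)
open import Data.Unit using (⊤)
open import Relation.Nullary using (¬_)
open import Relation.Binary.PropositionalEquality using (_≡_)
open import Relation.Binary.Structures using (IsDecEquivalence)

-- A (candidate) partition of [m] = Fin m (0-based: element p ∈ Fin m is p+1 ∈ [m]),
-- given by its "same block" relation.
BRel : ℕ → Set₁
BRel m = Fin m → Fin m → Set

IsPartition : ∀ {m} → BRel m → Set
IsPartition {m} π = IsDecEquivalence {A = Fin m} π

NonCrossing : ∀ {m} → BRel m → Set
NonCrossing {m} π =
  (a b c d : Fin m) → a < b → b < c → c < d → ¬ (π a c × π b d × ¬ π a b)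

IsNCP : ∀ {m} → BRel m → Set
IsNCP π = IsPartition π × NonCrossing π

_⊑_ : ∀ {m} → BRel m → BRel m → Set
π ⊑ σ = ∀ i j → π i j → σ i j

_≐_ : ∀ {m} → BRel m → BRel m → Set
π ≐ σ = ∀ i j → (π i j → σ i j) × (σ i j → π i j)

-- the partition of [m] given by a block-labelling t (blocks = nonempty fibres of t);
-- every partition of [m] arises this way.
LabelRel : ∀ {m} → (Fin m → Fin m) → BRel m
LabelRel t i j = t i ≡ t j

-- Join in the lattice NCP(m): the meet (= intersection, which is the meet in NCP(m))
-- of all noncrossing partitions lying above both π and σ, i.e. the least
-- noncrossing upper bound.
_∨_ : ∀ {m} → BRel m → BRel m → BRel m
_∨_ {m} π σ i j =
  (t : Fin m → Fin m) → NonCrossing (LabelRel t) →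
  π ⊑ LabelRel t → σ ⊑ LabelRel t → t i ≡ t j

-- α₁ ∗ₙ ⋯ ∗ₙ αₖ, a partition of [kn], here indexed by Fin (n * k):
-- the element combine x i (= x*k + i, 0-based) corresponds to k(x-1)+i (1-based),
-- with x ∈ [n] and i ∈ [k].
star : ∀ {n k} → Vec (BRel n) k → BRel (n * k)
star {n} {k} αs p q =
  Σ (remainder {n} k p ≡ remainder {n} k q)
    (λ _ → lookup αs (remainder {n} k p) (quotient {n} k p) (quotient {n} k q))

blocks : ∀ n k → BRel (n * k)
blocks n k p q = quotient {n} k p ≡ quotient {n} k q

-- γ^{1/k} for k = suc k′: blocks {i : ik ∈ D}; ik (1-based) is combine i (fromℕ k′)
root : ∀ {n} k′ → BRel (n * suc k′) → BRel n
root k′ γ x y = γ (combine x (fromℕ k′)) (combine y (fromℕ k′))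

Admissible : ∀ {n k} → Vec (BRel n) k → Set
Admissible αs = NonCrossing (star αs)

-- α ∘ β (the formula; meaningful when the pair is admissible)
_∘_ : ∀ {n} → BRel n → BRel n → BRel n
_∘_ {n} α β = root 1 (star (α ∷ β ∷ []) ∨ blocks n 2)

DefinedPair : ∀ {n} → BRel n → BRel n → Set
DefinedPair α β = IsNCP α × IsNCP β × Admissible (α ∷ β ∷ [])

iterProd : ∀ {n k} → BRel n → Vec (BRel n) k → BRel n
iterProd acc [] = acc
iterProd acc (β ∷ βs) = iterProd (acc ∘ β) βs

IterDefined : ∀ {n k} → BRel n → Vec (BRel n) k → Set
IterDefined acc [] = ⊤
IterDefined acc (β ∷ βs) = DefinedPair acc β × IterDefined (acc ∘ β) βs

{-# OPTIONS --safe #-}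
module Submission where

-- Both sides equal the join α₁ ∨ ⋯ ∨ αₖ in NCP(n).  On the right, a noncrossing partition of [kn]
-- above α₁ ∗ₙ ⋯ ∗ₙ αₖ and the blocks {(i-1)k+1, …, ik} restricts (on the positions ik) to a
-- noncrossing partition of [n] above every αᵢ, and conversely every such partition of [n] inflates
-- to one of [kn] above both; so the root of the join is the join of the αᵢ.
-- On the left, admissibility of (αᵢ, αⱼ) for i < j says that for any u < v in one block of αⱼ,
-- αᵢ lies below the noncrossing two-block partition {(u, v], rest}.  This property passes to
-- joins, so every partial product α₁ ∘ ⋯ ∘ αⱼ = α₁ ∨ ⋯ ∨ αⱼ stays admissible with the later
-- factors, and the product is computed step by step as an iterated join.

open import Defs
open import Data.Nat using (ℕ; suc)
open import Data.Fin using (Fin)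
open import Data.Product using (_×_)
open import Data.Vec using (Vec; _∷_; lookup)

import Data.Nat as ℕ
open import Data.Nat using (z≤n; s≤s)
import Data.Nat.Properties as ℕₚ
open import Data.Empty using (⊥-elim)
open import Data.Fin
  using (zero; suc; _<_; _≤_; combine; quotient; remainder; fromℕ; fromℕ<; inject; toℕ
        ; finToFun; funToFin)
open import Data.Fin.Properties
  using ( _≟_; ≡-isDecEquivalence; _<?_; _≤?_; all?; <-cmp; ≤-antisym; ≤-reflexive; ≤∧≢⇒<; <⇒≢
        ; toℕ-injective; toℕ-fromℕ<; toℕ-inject; toℕ-combine; remQuot-combine; combine-remQuot
        ; combine-monoˡ-<; combine-injectiveˡ; ¬∀⟶∃¬-smallest; finToFun-funToFin )
open import Data.Product using (_,_; proj₁; proj₂; ∃; uncurry; swap)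
import Data.Product as Product
open import Data.Sum using (_⊎_; inj₁; inj₂)
open import Data.Unit using (⊤; tt)
open import Data.Vec using ([]; _++_)
open import Data.Vec.Relation.Unary.All as All using (All; []; _∷_)
open import Data.Vec.Relation.Unary.All.Properties using (lookup⁺; lookup⁻)
open import Data.Vec.Relation.Unary.AllPairs using (AllPairs; []; _∷_)
open import Relation.Binary.Definitions using (Decidable; Symmetric; tri<; tri≈; tri>)
open import Relation.Binary.Structures using (IsDecEquivalence)
import Relation.Binary.Construct.On as On
open import Relation.Binary.PropositionalEquality
  using (_≡_; refl; sym; trans; cong; subst; subst₂; _≗_; module ≡-Reasoning)
open import Relation.Nullary using (¬_; Dec; yes; no; ¬?; contradiction)
open import Relation.Nullary.Decidable using (_×-dec_; _→-dec_; map′; decidable-stable; toSum)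

private variable
  m n k : ℕ
  π σ ρ γ δ β : BRel m

≐-sym : π ≐ σ → σ ≐ π
≐-sym π≐σ i j = swap (π≐σ i j)

≐-trans : π ≐ σ → σ ≐ ρ → π ≐ ρ
≐-trans π≐σ σ≐ρ i j =
  (λ h → proj₁ (σ≐ρ i j) (proj₁ (π≐σ i j) h)) , (λ h → proj₂ (π≐σ i j) (proj₂ (σ≐ρ i j) h))

⊑-trans : π ⊑ σ → σ ⊑ ρ → π ⊑ ρ
⊑-trans π⊑σ σ⊑ρ i j h = σ⊑ρ i j (π⊑σ i j h)

≐⇒⊑ : π ≐ σ → π ⊑ σ
≐⇒⊑ π≐σ i j = proj₁ (π≐σ i j)

NonCrossing-resp-≐ : π ≐ σ → NonCrossing π → NonCrossing σ
NonCrossing-resp-≐ π≐σ nc a b c d a<b b<c c<d (ac , bd , ¬ab) =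
  nc a b c d a<b b<c c<d (proj₂ (π≐σ a c) ac , proj₂ (π≐σ b d) bd , λ h → ¬ab (proj₁ (π≐σ a b) h))

IsDecEquivalence-resp-≐ : π ≐ σ → IsDecEquivalence π → IsDecEquivalence σ
IsDecEquivalence-resp-≐ {π = π} {σ = σ} π≐σ E = record
  { isEquivalence = record
    { refl  = to E.refl
    ; sym   = λ h → to (E.sym (from h))
    ; trans = λ h h′ → to (E.trans (from h) (from h′))
    }
  ; _≟_ = λ i j → map′ to from (i E.≟ j)
  }
  where
  module E = IsDecEquivalence E
  to : ∀ {i j} → π i j → σ i j
  to = proj₁ (π≐σ _ _)
  from : ∀ {i j} → σ i j → π i j
  from = proj₂ (π≐σ _ _)

IsNCP-resp-≐ : π ≐ σ → IsNCP π → IsNCP σ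
IsNCP-resp-≐ π≐σ = Product.map (IsDecEquivalence-resp-≐ π≐σ) (NonCrossing-resp-≐ π≐σ)

IsNCP⇒symmetric : IsNCP π → Symmetric π
IsNCP⇒symmetric (E , _) = IsDecEquivalence.sym E

IsNCP⇒decidable : IsNCP π → Decidable π
IsNCP⇒decidable (E , _) = IsDecEquivalence._≟_ E

LabelRel-≗ : {s t : Fin m → Fin m} → s ≗ t → LabelRel s ≐ LabelRel t
LabelRel-≗ s≗t i j =
  (λ e → trans (sym (s≗t i)) (trans e (s≗t j))) , (λ e → trans (s≗t i) (trans e (sym (s≗t j))))

nonCrossing? : Decidable π → Dec (NonCrossing π)
nonCrossing? π? = all? λ a → all? λ b → all? λ c → all? λ d →
  a <? b →-dec b <? c →-dec c <? d →-dec ¬? (π? a c ×-dec π? b d ×-dec ¬? (π? a b))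

⊑? : Decidable π → Decidable σ → Dec (π ⊑ σ)
⊑? π? σ? = all? λ i → all? λ j → π? i j →-dec σ? i j

allFunctions? : (P : (Fin m → Fin n) → Set) → (∀ {f g} → f ≗ g → P f → P g) →
                (∀ f → Dec (P f)) → Dec (∀ f → P f)
allFunctions? P resp P? = map′ (λ h f → resp (finToFun-funToFin f) (h (funToFin f)))
                               (λ h i → h (finToFun i))
                               (all? λ i → P? (finToFun i))

noncrossing-pullback : {A : Set} {s : Fin n → A} {f : Fin m → Fin n} →
                       NonCrossing (λ a b → s a ≡ s b) → (∀ {a b} → a < b → f a ≤ f b) →
                       NonCrossing (λ a b → s (f a) ≡ s (f b))
noncrossing-pullback {s = s} {f} nc f-mono a b c d a<b b<c c<d (ac , bd , ¬ab) =
  nc (f a) (f b) (f c) (f d) fa<fb fb<fc fc<fd (ac , bd , ¬ab)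
  where
  fa<fb = ≤∧≢⇒< (f-mono a<b) λ e → ¬ab (cong s e)
  fb<fc = ≤∧≢⇒< (f-mono b<c) λ e → ¬ab (trans ac (sym (cong s e)))
  fc<fd = ≤∧≢⇒< (f-mono c<d) λ e → ¬ab (trans ac (trans (cong s e) (sym bd)))

module _ {R : BRel m} (R-isDecEquivalence : IsDecEquivalence R) where
  open IsDecEquivalence R-isDecEquivalence
    using () renaming (refl to R-refl; sym to R-sym; trans to R-trans; _≟_ to _≟R_)

  private
    leastRelated : (x : Fin m) → ∃ λ c → ¬ ¬ R c x × ((j : Fin (toℕ c)) → ¬ R (inject j) x)
    leastRelated x = ¬∀⟶∃¬-smallest m (λ c → ¬ R c x) (λ c → ¬? (c ≟R x)) (λ h → h x R-refl)

  canonicalLabel : Fin m → Fin m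
  canonicalLabel x = proj₁ (leastRelated x)

  canonicalLabel-related : ∀ x → R (canonicalLabel x) x
  canonicalLabel-related x = decidable-stable (canonicalLabel x ≟R x) (proj₁ (proj₂ (leastRelated x)))

  canonicalLabel-least : ∀ {x c} → R c x → canonicalLabel x ≤ c
  canonicalLabel-least {x} {c} Rcx = ℕₚ.≮⇒≥ λ c<label →
    proj₂ (proj₂ (leastRelated x)) (fromℕ< c<label)
          (subst (λ d → R d x) (sym (inject-fromℕ< c<label)) Rcx)
    where
    inject-fromℕ< : ∀ {c d : Fin m} (c<d : c < d) → inject (fromℕ< c<d) ≡ c
    inject-fromℕ< c<d = toℕ-injective (trans (toℕ-inject (fromℕ< c<d)) (toℕ-fromℕ< c<d))

  canonicalLabel-≐ : LabelRel canonicalLabel ≐ R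
  canonicalLabel-≐ x y = to , from
    where
    to : canonicalLabel x ≡ canonicalLabel y → R x y
    to e = R-trans (R-sym (canonicalLabel-related x))
                   (subst (λ c → R c y) (sym e) (canonicalLabel-related y))
    from : R x y → canonicalLabel x ≡ canonicalLabel y
    from Rxy = ≤-antisym (canonicalLabel-least (R-trans (canonicalLabel-related y) (R-sym Rxy)))
                         (canonicalLabel-least (R-trans (canonicalLabel-related x) Rxy))

-- Joins in NCP(m)

UpperBound : Vec (BRel m) k → (Fin m → Fin m) → Set
UpperBound []      s = ⊤
UpperBound (γ ∷ V) s = γ ⊑ LabelRel s × UpperBound V s

module _ {s : Fin m → Fin m} where

  upperBound-lookup : (V : Vec (BRel m) k) → UpperBound V s → ∀ i → lookup V i ⊑ LabelRel s
  upperBound-lookup (γ ∷ V) (γ⊑s , _)  zero    = γ⊑s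
  upperBound-lookup (γ ∷ V) (_   , ub) (suc i) = upperBound-lookup V ub i

  upperBound-tabulate : (V : Vec (BRel m) k) → (∀ i → lookup V i ⊑ LabelRel s) → UpperBound V s
  upperBound-tabulate []      _  = tt
  upperBound-tabulate (γ ∷ V) ub = ub zero , upperBound-tabulate V (λ i → ub (suc i))

  upperBound-++⁺ : {k′ : ℕ} (W : Vec (BRel m) k) {V : Vec (BRel m) k′} →
                   UpperBound W s → UpperBound V s → UpperBound (W ++ V) s
  upperBound-++⁺ []      _             ubV = ubV
  upperBound-++⁺ (γ ∷ W) (γ⊑s , ubW) ubV = γ⊑s , upperBound-++⁺ W ubW ubV

  upperBound-++⁻ : {k′ : ℕ} (W : Vec (BRel m) k) {V : Vec (BRel m) k′} →
                   UpperBound (W ++ V) s → UpperBound W s × UpperBound V s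
  upperBound-++⁻ []      ub         = tt , ub
  upperBound-++⁻ (γ ∷ W) (γ⊑s , ub) = Product.map₁ (γ⊑s ,_) (upperBound-++⁻ W ub)

⋁ : Vec (BRel m) k → BRel m
⋁ V i j = ∀ s → NonCrossing (LabelRel s) → UpperBound V s → s i ≡ s j

⋁-upper : (V : Vec (BRel m) k) → ∀ i → lookup V i ⊑ ⋁ V
⋁-upper V i x y h s _ ub = upperBound-lookup V ub i x y h

⋁-⊑⇒upperBound : (V : Vec (BRel m) k) {s : Fin m → Fin m} → ⋁ V ⊑ LabelRel s → UpperBound V s
⋁-⊑⇒upperBound V ⋁V⊑s = upperBound-tabulate V (λ i → ⊑-trans (⋁-upper V i) ⋁V⊑s)

⋁-least : {V : Vec (BRel m) k} {s : Fin m → Fin m} →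
          NonCrossing (LabelRel s) → UpperBound V s → ⋁ V ⊑ LabelRel s
⋁-least nc ub i j h = h _ nc ub

⋁-cong : {k′ : ℕ} {V : Vec (BRel m) k} {W : Vec (BRel m) k′} →
         (∀ {s} → NonCrossing (LabelRel s) → UpperBound V s → UpperBound W s) →
         (∀ {s} → NonCrossing (LabelRel s) → UpperBound W s → UpperBound V s) →
         ⋁ V ≐ ⋁ W
⋁-cong V⇒W W⇒V i j = (λ h s nc ub → h s nc (W⇒V nc ub)) , (λ h s nc ub → h s nc (V⇒W nc ub))

⋁-assoc : {k′ : ℕ} (W : Vec (BRel m) k) {V : Vec (BRel m) k′} → γ ≐ ⋁ W → ⋁ (γ ∷ V) ≐ ⋁ (W ++ V)
⋁-assoc W γ≐⋁W = ⋁-cong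
  (λ _ (γ⊑s , ub) → upperBound-++⁺ W (⋁-⊑⇒upperBound W (⊑-trans (≐⇒⊑ (≐-sym γ≐⋁W)) γ⊑s)) ub)
  (λ nc ub → let ubW , ubV = upperBound-++⁻ W ub in ⊑-trans (≐⇒⊑ γ≐⋁W) (⋁-least nc ubW) , ubV)

⋁-singleton : IsNCP γ → ⋁ (γ ∷ []) ≐ γ
⋁-singleton (E , nc) i j =
  (λ h → proj₁ (canonicalLabel-≐ E i j) (h (canonicalLabel E) canonical-nc (γ⊑canonical , tt)))
  , (λ h s _ (γ⊑s , _) → γ⊑s i j h)
  where
  canonical-nc = NonCrossing-resp-≐ (≐-sym (canonicalLabel-≐ E)) nc
  γ⊑canonical = ≐⇒⊑ (≐-sym (canonicalLabel-≐ E))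

⋁-noncrossing : (V : Vec (BRel m) k) → NonCrossing (⋁ V)
⋁-noncrossing V a b c d a<b b<c c<d (ac , bd , ¬ab) = ¬ab λ s nc ub →
  decidable-stable (s a ≟ s b) λ sa≢sb → nc a b c d a<b b<c c<d (ac s nc ub , bd s nc ub , sa≢sb)

upperBound? : {V : Vec (BRel m) k} → All Decidable V → (s : Fin m → Fin m) → Dec (UpperBound V s)
upperBound? []        s = yes tt
upperBound? (γ? ∷ V?) s = ⊑? γ? (λ i j → s i ≟ s j) ×-dec upperBound? V? s

upperBound-resp-≐ : (V : Vec (BRel m) k) {s t : Fin m → Fin m} →
                    LabelRel s ≐ LabelRel t → UpperBound V s → UpperBound V t
upperBound-resp-≐ []      s≐t _          = tt
upperBound-resp-≐ (γ ∷ V) s≐t (γ⊑s , ub) = ⊑-trans γ⊑s (≐⇒⊑ s≐t) , upperBound-resp-≐ V s≐t ub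

⋁-isNCP : {V : Vec (BRel m) k} → All Decidable V → IsNCP (⋁ V)
⋁-isNCP {V = V} V? = record
  { isEquivalence = record
    { refl  = λ _ _ _ → refl
    ; sym   = λ h s nc ub → sym (h s nc ub)
    ; trans = λ h h′ s nc ub → trans (h s nc ub) (h′ s nc ub)
    }
  ; _≟_ = λ i j → allFunctions? _ (resp i j) λ s →
      nonCrossing? (λ a b → s a ≟ s b) →-dec upperBound? V? s →-dec s i ≟ s j
  } , ⋁-noncrossing V
  where
  resp : ∀ i j {s t} → s ≗ t →
         (NonCrossing (LabelRel s) → UpperBound V s → s i ≡ s j) →
         (NonCrossing (LabelRel t) → UpperBound V t → t i ≡ t j)
  resp i j s≗t h nc ub = proj₁ (LabelRel-≗ s≗t i j)
    (h (NonCrossing-resp-≐ t≐s nc) (upperBound-resp-≐ V t≐s ub))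
    where t≐s = ≐-sym (LabelRel-≗ s≗t)

-- Positions in [nk]: combine x r stands for x·k + r

module _ {n k : ℕ} where

  quotient-combine : (x : Fin n) (r : Fin k) → quotient {n} k (combine x r) ≡ x
  quotient-combine x r = cong proj₁ (remQuot-combine x r)

  remainder-combine : (x : Fin n) (r : Fin k) → remainder {n} k (combine x r) ≡ r
  remainder-combine x r = cong proj₂ (remQuot-combine x r)

  combine-mono-≤-< : {x x′ : Fin n} {r r′ : Fin k} → x ≤ x′ → r < r′ → combine x r < combine x′ r′
  combine-mono-≤-< {x} {x′} {r} {r′} x≤x′ r<r′ =
    subst₂ ℕ._<_ (sym (toℕ-combine x r)) (sym (toℕ-combine x′ r′))
                 (ℕₚ.+-mono-≤-< (ℕₚ.*-monoʳ-≤ k x≤x′) r<r′)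

  combine-monoʳ-≤ : (x : Fin n) {r r′ : Fin k} → r ≤ r′ → combine x r ≤ combine x r′
  combine-monoʳ-≤ x {r} {r′} r≤r′ =
    subst₂ ℕ._≤_ (sym (toℕ-combine x r)) (sym (toℕ-combine x r′)) (ℕₚ.+-monoʳ-≤ (k ℕ.* toℕ x) r≤r′)

  quotient-mono : {p p′ : Fin (n ℕ.* k)} → p < p′ → quotient {n} k p ≤ quotient {n} k p′
  quotient-mono {p} {p′} p<p′ = ℕₚ.≮⇒≥ λ q′<q →
    ℕₚ.<-asym p<p′ (subst₂ _<_ (combine-remQuot {n} k p′) (combine-remQuot {n} k p)
                               (combine-monoˡ-< _ _ q′<q))

  quotient-< : {p p′ : Fin (n ℕ.* k)} → p < p′ → remainder {n} k p′ ≤ remainder {n} k p →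
               quotient {n} k p < quotient {n} k p′
  quotient-< {p} {p′} p<p′ r′≤r = ≤∧≢⇒< (quotient-mono p<p′) λ q≡q′ →
    ℕₚ.<⇒≱ p<p′ (subst₂ _≤_ (combine-remQuot {n} k p′)
                            (trans (cong (λ x → combine x _) (sym q≡q′)) (combine-remQuot {n} k p))
                            (combine-monoʳ-≤ (quotient {n} k p′) r′≤r))

star-intro : (V : Vec (BRel n) k) (r : Fin k) {x y : Fin n} →
             lookup V r x y → star V (combine x r) (combine y r)
star-intro V r {x} {y} h
  rewrite remainder-combine x r | remainder-combine y r | quotient-combine x r | quotient-combine y r
  = refl , h

module _ {n k : ℕ} (V : Vec (BRel n) (suc k)) where
  private
    lastOf : Fin n → Fin (n ℕ.* suc k)
    lastOf x = combine x (fromℕ k)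

    sameBlock : (t : Fin (n ℕ.* suc k) → Fin (n ℕ.* suc k)) → blocks n (suc k) ⊑ LabelRel t →
                ∀ x r → t (combine x r) ≡ t (lastOf x)
    sameBlock t blocks⊑t x r =
      blocks⊑t _ _ (trans (quotient-combine x r) (sym (quotient-combine x (fromℕ k))))

  root-∨⊑⋁ : root k (star V ∨ blocks n (suc k)) ⊑ ⋁ V
  root-∨⊑⋁ x y h s nc ub =
    subst₂ (λ a b → s a ≡ s b) (quotient-combine x (fromℕ k)) (quotient-combine y (fromℕ k))
      (combine-injectiveˡ _ zero _ zero (h t t-nc star⊑t blocks⊑t))
    where
    -- s inflated to [n(k+1)]; combine _ zero only serves to embed its labels into Fin (n * suc k).
    t : Fin (n ℕ.* suc k) → Fin (n ℕ.* suc k)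
    t p = combine (s (quotient {n} (suc k) p)) zero
    t-nc : NonCrossing (LabelRel t)
    t-nc = NonCrossing-resp-≐ (λ p p′ → cong (λ x → combine x zero) , combine-injectiveˡ _ zero _ zero)
                              (noncrossing-pullback nc quotient-mono)
    star⊑t : star V ⊑ LabelRel t
    star⊑t p p′ (_ , h) =
      cong (λ x → combine x zero) (upperBound-lookup V ub (remainder {n} (suc k) p) _ _ h)
    blocks⊑t : blocks n (suc k) ⊑ LabelRel t
    blocks⊑t p p′ q≡q′ = cong (λ x → combine (s x) zero) q≡q′

  ⋁⊑root-∨ : ⋁ V ⊑ root k (star V ∨ blocks n (suc k))
  ⋁⊑root-∨ x y h t nc star⊑t blocks⊑t = proj₁ (canonicalLabel-≐ E x y) (h s s-nc ub)
    where
    R : BRel n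
    R x y = t (lastOf x) ≡ t (lastOf y)
    E : IsDecEquivalence R
    E = On.isDecEquivalence lastOf (On.isDecEquivalence t ≡-isDecEquivalence)
    s : Fin n → Fin n
    s = canonicalLabel E
    s-nc : NonCrossing (LabelRel s)
    s-nc = NonCrossing-resp-≐ (≐-sym (canonicalLabel-≐ E))
                              (noncrossing-pullback nc (λ x<y → ℕₚ.<⇒≤ (combine-monoˡ-< _ _ x<y)))
    ub : UpperBound V s
    ub = upperBound-tabulate V λ r u v h → proj₂ (canonicalLabel-≐ E u v) (begin
      t (lastOf u)     ≡⟨ sameBlock t blocks⊑t u r ⟨
      t (combine u r)  ≡⟨ star⊑t _ _ (star-intro V r h) ⟩
      t (combine v r)  ≡⟨ sameBlock t blocks⊑t v r ⟩
      t (lastOf v)     ∎)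
      where open ≡-Reasoning

  root-∨≐⋁ : root k (star V ∨ blocks n (suc k)) ≐ ⋁ V
  root-∨≐⋁ x y = root-∨⊑⋁ x y , ⋁⊑root-∨ x y

-- Admissibility

_∈⟨_,_] : Fin n → Fin n → Fin n → Set
w ∈⟨ u , v ] = u < w × w ≤ v

_∈?⟨_,_] : (w u v : Fin n) → Dec (w ∈⟨ u , v ])
w ∈?⟨ u , v ] = u <? w ×-dec w ≤? v

∈⟨,]-trichotomy : (w u v : Fin n) → w ≤ u ⊎ w ∈⟨ u , v ] ⊎ v < w
∈⟨,]-trichotomy w u v with u <? w | w ≤? v
... | no  u≮w | _       = inj₁ (ℕₚ.≮⇒≥ u≮w)
... | yes u<w | yes w≤v = inj₂ (inj₁ (u<w , w≤v))
... | yes _   | no  w≰v = inj₂ (inj₂ (ℕₚ.≰⇒> w≰v))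

∈⟨,]-convex : {u v a b c : Fin n} → a ∈⟨ u , v ] → c ∈⟨ u , v ] → a < b → b < c → b ∈⟨ u , v ]
∈⟨,]-convex (u<a , _) (_ , c≤v) a<b b<c = ℕₚ.<-trans u<a a<b , ℕₚ.<⇒≤ (ℕₚ.<-≤-trans b<c c≤v)

-- The pairwise form of admissibility, for γ in an earlier slot than β.
Compatible : BRel n → BRel n → Set
Compatible γ β = ∀ {u v y z} → β u v → γ y z → y ∈⟨ u , v ] → z ∈⟨ u , v ]

Compatible-resp-≐ : π ≐ σ → Compatible π β → Compatible σ β
Compatible-resp-≐ π≐σ compat β-uv σ-yz = compat β-uv (proj₂ (π≐σ _ _) σ-yz)

module _ {n : ℕ} (u v : Fin n) where

  indicator : Fin n → Fin n
  indicator w with w ∈?⟨ u , v ]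
  ... | yes _ = v
  ... | no  _ = u

  indicator-∈ : ∀ {w} → w ∈⟨ u , v ] → indicator w ≡ v
  indicator-∈ {w} w∈ with w ∈?⟨ u , v ]
  ... | yes _  = refl
  ... | no  w∉ = contradiction w∈ w∉

  indicator-∉ : ∀ {w} → ¬ w ∈⟨ u , v ] → indicator w ≡ u
  indicator-∉ {w} w∉ with w ∈?⟨ u , v ]
  ... | yes w∈ = contradiction w∈ w∉
  ... | no  _  = refl

  indicator-≡-∈ : ∀ {x y} → indicator x ≡ indicator y → x ∈⟨ u , v ] → y ∈⟨ u , v ]
  indicator-≡-∈ {x} {y} ix≡iy x∈@(u<x , x≤v) with toSum (y ∈?⟨ u , v ])
  ... | inj₁ y∈ = y∈
  ... | inj₂ y∉ = contradiction (trans (sym (indicator-∉ y∉)) (trans (sym ix≡iy) (indicator-∈ x∈)))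
                               (<⇒≢ (ℕₚ.<-≤-trans u<x x≤v))

  indicator-noncrossing : NonCrossing (LabelRel indicator)
  indicator-noncrossing a b c d a<b b<c c<d (ac , bd , ¬ab)
    with toSum (a ∈?⟨ u , v ]) | toSum (b ∈?⟨ u , v ])
  ... | inj₁ a∈ | _       =
    ¬ab (trans (indicator-∈ a∈) (sym (indicator-∈ (∈⟨,]-convex a∈ (indicator-≡-∈ ac a∈) a<b b<c))))
  ... | inj₂ a∉ | inj₁ b∈ = a∉ (indicator-≡-∈ (sym ac) (∈⟨,]-convex b∈ (indicator-≡-∈ bd b∈) b<c c<d))
  ... | inj₂ a∉ | inj₂ b∉ = ¬ab (trans (indicator-∉ a∉) (sym (indicator-∉ b∉)))

  compatible⇒⊑indicator : Symmetric γ → Compatible γ β → β u v → γ ⊑ LabelRel indicator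
  compatible⇒⊑indicator γ-sym compat β-uv y z γ-yz with toSum (y ∈?⟨ u , v ]) | toSum (z ∈?⟨ u , v ])
  ... | inj₁ y∈ | _       = trans (indicator-∈ y∈) (sym (indicator-∈ (compat β-uv γ-yz y∈)))
  ... | inj₂ y∉ | inj₁ z∈ = contradiction (compat β-uv (γ-sym γ-yz) z∈) y∉
  ... | inj₂ y∉ | inj₂ z∉ = trans (indicator-∉ y∉) (sym (indicator-∉ z∉))

⋁-compatible : {V : Vec (BRel n) k} → All Symmetric V → All (λ γ → Compatible γ β) V →
               Compatible (⋁ V) β
⋁-compatible {β = β} syms compats {u} {v} β-uv ⋁-yz =
  indicator-≡-∈ u v (⋁-yz (indicator u v) (indicator-noncrossing u v) (below syms compats))
  where
  below : {W : Vec (BRel _) k} → All Symmetric W → All (λ γ → Compatible γ β) W →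
          UpperBound W (indicator u v)
  below []              []                  = tt
  below (γ-sym ∷ syms′) (compat ∷ compats′) =
    compatible⇒⊑indicator u v γ-sym compat β-uv , below syms′ compats′

module _ {A : Set₁} {R : A → A → Set} where

  allPairs-lookup⁺ : {V : Vec A k} → AllPairs R V → ∀ {i j} → i < j → R (lookup V i) (lookup V j)
  allPairs-lookup⁺ (Rx ∷ _)   {zero}  {suc j} _         = lookup⁺ Rx j
  allPairs-lookup⁺ (_  ∷ Rxs) {suc i} {suc j} (s≤s i<j) = allPairs-lookup⁺ Rxs i<j

  allPairs-lookup⁻ : {V : Vec A k} → (∀ {i j} → i < j → R (lookup V i) (lookup V j)) → AllPairs R V
  allPairs-lookup⁻ {V = []}    _ = []
  allPairs-lookup⁻ {V = x ∷ V} R< =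
    lookup⁻ (λ j → R< {zero} {suc j} (s≤s z≤n)) ∷ allPairs-lookup⁻ (λ i<j → R< (s≤s i<j))

module _ {n k : ℕ} {V : Vec (BRel n) k} (ncps : All IsNCP V) where
  private
    q : Fin (n ℕ.* k) → Fin n
    q = quotient {n} k
    r : Fin (n ℕ.* k) → Fin k
    r = remainder {n} k
    lookup-sym : ∀ i → Symmetric (lookup V i)
    lookup-sym i = IsNCP⇒symmetric (lookup⁺ ncps i)

  compatible⇒admissible : AllPairs Compatible V → Admissible V
  compatible⇒admissible compats a b c d a<b b<c c<d ((ra≡rc , ac) , (rb≡rd , bd) , ¬ab)
    with <-cmp (r a) (r b)
  ... | tri≈ _ ra≡rb _ =
    proj₂ (lookup⁺ ncps (r a)) (q a) (q b) (q c) (q d)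
      (quotient-< a<b (≤-reflexive (sym ra≡rb)))
      (quotient-< b<c (≤-reflexive (trans (sym ra≡rc) ra≡rb)))
      (quotient-< c<d (≤-reflexive (trans (sym rb≡rd) (trans (sym ra≡rb) ra≡rc))))
      (ac , subst (λ i → lookup V i (q b) (q d)) (sym ra≡rb) bd , λ h → ¬ab (ra≡rb , h))
  ... | tri< ra<rb _ _ =
    ℕₚ.<⇒≱ (proj₁ (allPairs-lookup⁺ compats ra<rb bd (lookup-sym (r a) ac) (qb<qc , quotient-mono c<d)))
           (quotient-mono a<b)
    where qb<qc = quotient-< b<c (ℕₚ.<⇒≤ (subst (_< r b) ra≡rc ra<rb))
  ... | tri> _ _ rb<ra =
    ℕₚ.<⇒≱ (quotient-< c<d (ℕₚ.<⇒≤ (subst₂ _<_ rb≡rd ra≡rc rb<ra)))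
           (proj₂ (allPairs-lookup⁺ compats rb<ra ac bd (qa<qb , quotient-mono b<c)))
    where qa<qb = quotient-< a<b (ℕₚ.<⇒≤ rb<ra)

  admissible⇒compatible : Admissible V → AllPairs Compatible V
  admissible⇒compatible admissible = allPairs-lookup⁻ compatible
    where
    slots : ∀ {i j} {x y : Fin n} → star V (combine x i) (combine y j) → i ≡ j
    slots {i} {j} {x} {y} (ri≡rj , _) =
      trans (sym (remainder-combine x i)) (trans ri≡rj (remainder-combine y j))

    compatible : ∀ {i j} → i < j → Compatible (lookup V i) (lookup V j)
    compatible {i} {j} i<j {u} {v} {y} {z} β-uv γ-yz (u<y , y≤v) with ∈⟨,]-trichotomy z u v
    ... | inj₁ z≤u =
      ⊥-elim (admissible (combine z i) (combine u j) (combine y i) (combine v j)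
        (combine-mono-≤-< z≤u i<j) (combine-monoˡ-< j i u<y) (combine-mono-≤-< y≤v i<j)
        (star-intro V i (lookup-sym i γ-yz) , star-intro V j β-uv , λ h → <⇒≢ i<j (slots h)))
    ... | inj₂ (inj₁ z∈) = z∈
    ... | inj₂ (inj₂ v<z) =
      ⊥-elim (admissible (combine u j) (combine y i) (combine v j) (combine z i)
        (combine-monoˡ-< j i u<y) (combine-mono-≤-< y≤v i<j) (combine-monoˡ-< j i v<z)
        (star-intro V j β-uv , star-intro V i γ-yz , λ h → <⇒≢ i<j (sym (slots h))))

-- Iterated products

∘≐⋁ : (γ β : BRel n) → (γ ∘ β) ≐ ⋁ (γ ∷ β ∷ [])
∘≐⋁ γ β = root-∨≐⋁ (γ ∷ β ∷ [])

∘-isNCP : IsNCP γ → IsNCP β → IsNCP (γ ∘ β)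
∘-isNCP {γ = γ} {β = β} γ-ncp β-ncp =
  IsNCP-resp-≐ (≐-sym (∘≐⋁ γ β)) (⋁-isNCP (IsNCP⇒decidable γ-ncp ∷ IsNCP⇒decidable β-ncp ∷ []))

∘-compatible : IsNCP γ → IsNCP β → Compatible γ δ → Compatible β δ → Compatible (γ ∘ β) δ
∘-compatible {γ = γ} {β = β} γ-ncp β-ncp γ-δ β-δ = Compatible-resp-≐ (≐-sym (∘≐⋁ γ β))
  (⋁-compatible (IsNCP⇒symmetric γ-ncp ∷ IsNCP⇒symmetric β-ncp ∷ []) (γ-δ ∷ β-δ ∷ []))

iterProd≐⋁ : (acc : BRel n) (βs : Vec (BRel n) k) →
             All IsNCP (acc ∷ βs) → AllPairs Compatible (acc ∷ βs) →
             IterDefined acc βs × (iterProd acc βs ≐ ⋁ (acc ∷ βs))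
iterProd≐⋁ acc [] (acc-ncp ∷ []) _ = tt , ≐-sym (⋁-singleton acc-ncp)
iterProd≐⋁ acc (β ∷ βs) (acc-ncp ∷ β-ncp ∷ βs-ncp) ((acc-β ∷ acc-βs) ∷ β-βs ∷ βs-compat) =
  (defined , proj₁ ih) , ≐-trans (proj₂ ih) (⋁-assoc (acc ∷ β ∷ []) (∘≐⋁ acc β))
  where
  defined : DefinedPair acc β
  defined = acc-ncp , β-ncp , compatible⇒admissible (acc-ncp ∷ β-ncp ∷ []) ((acc-β ∷ []) ∷ [] ∷ [])
  product-compatible : All (Compatible (acc ∘ β)) βs
  product-compatible = All.map (uncurry (∘-compatible acc-ncp β-ncp)) (All.zip (acc-βs , β-βs))
  ih : IterDefined (acc ∘ β) βs × (iterProd (acc ∘ β) βs ≐ ⋁ ((acc ∘ β) ∷ βs))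
  ih = iterProd≐⋁ (acc ∘ β) βs (∘-isNCP acc-ncp β-ncp ∷ βs-ncp) (product-compatible ∷ βs-compat)

lemma3p20 : {n k : ℕ} (α : BRel n) (αs : Vec (BRel n) k) →
    ((i : Fin (suc k)) → IsNCP (lookup (α ∷ αs) i)) →
    Admissible (α ∷ αs) →
    IterDefined α αs ×
    (iterProd α αs ≐ root k (star (α ∷ αs) ∨ blocks n (suc k)))
lemma3p20 α αs ncp admissible =
  Product.map₂ (λ product≐⋁ → ≐-trans product≐⋁ (≐-sym (root-∨≐⋁ (α ∷ αs))))
               (iterProd≐⋁ α αs ncps (admissible⇒compatible ncps admissible))
  where
  ncps : All IsNCP (α ∷ αs)
  ncps = lookup⁻ ncp
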